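{- Let $S,S'$ be strings of equal length with $S=_kS'$ and $S[i\,..\,j]=S'[i\,..\,j]$. Let $I=\mathsf{Misper}_{k+1}(S,i,j)$ and $I'=\mathsf{Misper}_{k+1}(S',i,j)$. If $I\cap I'=\emptyset$, then $\mathsf{Mis}(S,S')=I\cup I'$, $I=\mathsf{Misper}(S,i,j)$, and $I'=\mathsf{Misper}(S',i,j)$.
   Context: $S=_kS'$ means the Hamming distance between $S$ and $S'$ is at most $k$. $\mathsf{Mis}(S,S')=\{t\in[0\,..\,|S|-1]: S[t]\ne S'[t]\}$. A position $a$ of $S$ is a misperiod with respect to the fragment $S[i\,..\,j]$ if $S[a]\ne S[b]$, where $b$ is the unique position with $b\in[i\,..\,j]$ and $(j-i+1)\mid(b-a)$. $\mathsf{LeftMisper}_k(S,i,j)$ is the set of the $k$ largest misperiods smaller than $i$ and $\mathsf{RightMisper}_k(S,i,j)$ the set of the $k$ smallest misperiods greater than $j$ (fewer if not enough exist); $\mathsf{Misper}_k(S,i,j)$ is their union, and $\mathsf{Misper}(S,i,j)=\bigcup_{k\ge0}\mathsf{Misper}_k(S,i,j)$ (all misperiods with respect to $S[i\,..\,j]$). -}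

module Defs where

open import Data.Nat using (ℕ; zero; suc; _+_; _∸_; _≤_; _<_; _≤ᵇ_; _<?_)
open import Data.Nat.DivMod using (_%_)
open import Data.Bool using (if_then_else_)
open import Data.Fin using (Fin; fromℕ<)
open import Data.List using (List; upTo; map; filter; length)
open import Data.Maybe using (Maybe; just; nothing)
import Data.Maybe.Properties as MaybeP
open import Data.Vec using (Vec; lookup)
open import Data.Empty using (⊥)
open import Data.Product using (_×_; _,_)
open import Function.Bundles using (_⇔_)
open import Relation.Nullary using (¬_; Dec; yes; no)
open import Relation.Nullary.Decidable using (_×-dec_; ¬?)
open import Relation.Binary.PropositionalEquality using (_≡_; _≢_)
open import Relation.Binary.Definitions using (DecidableEquality)

at : {A : Set} {n : ℕ} → Vec A n → ℕ → Maybe A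
at {n = n} S a with a <? n
... | yes a<n = just (lookup S (fromℕ< a<n))
... | no _ = nothing

range : ℕ → ℕ → List ℕ
range lo hi = map (lo +_) (upTo (hi ∸ lo))

-- For the fragment S[i..j] (i ≤ j), the unique b ∈ [i..j] with (j-i+1) ∣ (b - a).
rep : ℕ → ℕ → ℕ → ℕ
rep i j a =
  if i ≤ᵇ a
  then i + ((a ∸ i) % suc (j ∸ i))
  else i + ((suc (j ∸ i) ∸ ((i ∸ a) % suc (j ∸ i))) % suc (j ∸ i))

IsMisper : {A : Set} {n : ℕ} → Vec A n → ℕ → ℕ → ℕ → Set
IsMisper {n = n} S i j a = a < n × at S a ≢ at S (rep i j a)

isMisper? : {A : Set} → DecidableEquality A → {n : ℕ} →
            (S : Vec A n) → (i j a : ℕ) → Dec (IsMisper S i j a)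
isMisper? _≟_ {n} S i j a = (a <? n) ×-dec ¬? (MaybeP.≡-dec _≟_ (at S a) (at S (rep i j a)))

countMisper : {A : Set} → DecidableEquality A → {n : ℕ} →
              Vec A n → ℕ → ℕ → ℕ → ℕ → ℕ
countMisper eq S i j lo hi = length (filter (isMisper? eq S i j) (range lo hi))

-- LeftMisper_k(S,i,j): the k largest misperiods smaller than i (fewer if not enough),
-- i.e. misperiods a < i with fewer than k misperiods strictly between a and i.
LeftMisper : {A : Set} → DecidableEquality A → {n : ℕ} →
             ℕ → Vec A n → ℕ → ℕ → ℕ → Set
LeftMisper eq k S i j a = IsMisper S i j a × a < i × countMisper eq S i j (suc a) i < k

-- RightMisper_k(S,i,j): the k smallest misperiods greater than j.
RightMisper : {A : Set} → DecidableEquality A → {n : ℕ} →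
              ℕ → Vec A n → ℕ → ℕ → ℕ → Set
RightMisper eq k S i j a = IsMisper S i j a × j < a × countMisper eq S i j (suc j) a < k

data Misperₖ {A : Set} (eq : DecidableEquality A) {n : ℕ}
             (k : ℕ) (S : Vec A n) (i j : ℕ) (a : ℕ) : Set where
  left  : LeftMisper eq k S i j a → Misperₖ eq k S i j a
  right : RightMisper eq k S i j a → Misperₖ eq k S i j a

Misper : {A : Set} {n : ℕ} → Vec A n → ℕ → ℕ → ℕ → Set
Misper S i j a = IsMisper S i j a

Mis : {A : Set} {n : ℕ} → Vec A n → Vec A n → ℕ → Set
Mis {n = n} S S' t = t < n × at S t ≢ at S' t

hamming : {A : Set} → DecidableEquality A → {n : ℕ} → Vec A n → Vec A n → ℕ
hamming _≟_ {n} S S' =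
  length (filter (λ t → ¬? (MaybeP.≡-dec _≟_ (at S t) (at S' t))) (range 0 n))

_=[_]_via_ : {A : Set} {n : ℕ} → Vec A n → ℕ → Vec A n → DecidableEquality A → Set
S =[ k ] S' via eq = hamming eq S S' ≤ k

_≐_ : (ℕ → Set) → (ℕ → Set) → Set
P ≐ Q = ∀ t → P t ⇔ Q t

data _∪_ (P Q : ℕ → Set) (t : ℕ) : Set where
  inl : P t → (P ∪ Q) t
  inr : Q t → (P ∪ Q) t

Disjoint : (ℕ → Set) → (ℕ → Set) → Set
Disjoint P Q = ∀ t → P t → Q t → ⊥

-- Since S and S' agree on [i..j], a position outside the fragment that is a
-- misperiod of exactly one of them is a mismatch of S and S', and every
-- mismatch is a misperiod of at least one of them.  Hence on any interval free
-- of common misperiods, the misperiods of S plus those of S' number at most the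
-- mismatches there, so at most k (the budget lemma).  A common misperiod
-- nearest to the fragment would then lie in both Misper_{k+1}-sets, against
-- disjointness; sweeping outwards from the fragment shows there is no common
-- misperiod at all.  So every interval carries at most k misperiods of each
-- string, every misperiod is among the k+1 nearest on its side, and the
-- mismatches are exactly the misperiods of S together with those of S'.
module Submission where

open import Level using (Level)
open import Defs
open import Data.Nat using (ℕ; zero; suc; _+_; _∸_; _≤_; _<_; _≤ᵇ_; z≤n; s≤s; _<?_)
open import Data.Nat.Properties
open import Data.Nat.DivMod using (_%_; m%n<n; m<n⇒m%n≡m)
open import Data.Bool using (true; false)
open import Data.List using (List; _∷_; _++_; length; filter; map; upTo; applyUpTo)
open import Data.List.Properties using (length-++; filter-++; map-upTo)
open import Data.List.Relation.Unary.All using (All; []; _∷_)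
open import Data.List.Relation.Unary.All.Properties using (applyUpTo⁺₁)
import Data.Maybe.Properties as MaybeP
open import Data.Vec using (Vec)
open import Data.Product using (_×_; _,_; proj₁)
open import Data.Sum using (_⊎_; inj₁; inj₂)
open import Data.Empty using (⊥-elim)
open import Function.Bundles using (mk⇔)
open import Relation.Nullary using (¬_; yes; no)
open import Relation.Nullary.Decidable using (¬?)
open import Relation.Unary using (Pred; Decidable)
open import Relation.Binary.PropositionalEquality
  using (_≡_; _≢_; _≗_; refl; sym; trans; cong; cong₂; subst; module ≡-Reasoning)
open import Relation.Binary.Definitions using (DecidableEquality)

private
  variable
    a p : Level
    X : Set a

count : {P : Pred X p} → Decidable P → List X → ℕ
count p? xs = length (filter p? xs)

count-++ : {P : Pred X p} (p? : Decidable P) (xs ys : List X) →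
           count p? (xs ++ ys) ≡ count p? xs + count p? ys
count-++ p? xs ys = trans (cong length (filter-++ p? xs ys)) (length-++ (filter p? xs))

count-disjoint-≤ : {P Q R : Pred X p} (p? : Decidable P) (q? : Decidable Q) (r? : Decidable R)
  {xs : List X} → All (λ x → ¬ (P x × Q x)) xs → All (λ x → P x ⊎ Q x → R x) xs →
  count p? xs + count q? xs ≤ count r? xs
count-disjoint-≤ p? q? r? [] [] = z≤n
count-disjoint-≤ p? q? r? {x ∷ xs} (disj ∷ disjs) (impl ∷ impls)
  with p? x | q? x | r? x | count-disjoint-≤ p? q? r? disjs impls
... | yes px | yes qx | _      | _  = ⊥-elim (disj (px , qx))
... | yes px | no _   | no ¬rx | _  = ⊥-elim (¬rx (impl (inj₁ px)))
... | no _   | yes qx | no ¬rx | _  = ⊥-elim (¬rx (impl (inj₂ qx)))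
... | yes _  | no _   | yes _  | ih = s≤s ih
... | no _   | yes _  | yes _  | ih =
  subst (_≤ suc (count r? xs)) (sym (+-suc (count p? xs) (count q? xs))) (s≤s ih)
... | no _   | no _   | yes _  | ih = m≤n⇒m≤1+n ih
... | no _   | no _   | no _   | ih = ih

applyUpTo-++ : (f : ℕ → X) (m n : ℕ) →
               applyUpTo f (m + n) ≡ applyUpTo f m ++ applyUpTo (λ x → f (m + x)) n
applyUpTo-++ f zero    n = refl
applyUpTo-++ f (suc m) n = cong (f 0 ∷_) (applyUpTo-++ (λ x → f (suc x)) m n)

applyUpTo-cong : {f g : ℕ → X} → f ≗ g → ∀ n → applyUpTo f n ≡ applyUpTo g n
applyUpTo-cong f≗g zero    = refl
applyUpTo-cong f≗g (suc n) = cong₂ _∷_ (f≗g 0) (applyUpTo-cong (λ x → f≗g (suc x)) n)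

range-split : ∀ {lo mid hi} → lo ≤ mid → mid ≤ hi →
              range lo hi ≡ range lo mid ++ range mid hi
range-split {lo} {mid} {hi} lo≤mid mid≤hi = begin
  map (lo +_) (upTo (hi ∸ lo))
    ≡⟨ map-upTo (lo +_) (hi ∸ lo) ⟩
  applyUpTo (lo +_) (hi ∸ lo)
    ≡⟨ cong (applyUpTo (lo +_)) length-split ⟩
  applyUpTo (lo +_) ((mid ∸ lo) + (hi ∸ mid))
    ≡⟨ applyUpTo-++ (lo +_) (mid ∸ lo) (hi ∸ mid) ⟩
  applyUpTo (lo +_) (mid ∸ lo) ++ applyUpTo (λ x → lo + ((mid ∸ lo) + x)) (hi ∸ mid)
    ≡⟨ cong₂ _++_ (sym (map-upTo (lo +_) (mid ∸ lo)))
                  (trans (applyUpTo-cong shift (hi ∸ mid)) (sym (map-upTo (mid +_) (hi ∸ mid)))) ⟩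
  map (lo +_) (upTo (mid ∸ lo)) ++ map (mid +_) (upTo (hi ∸ mid)) ∎
  where
  open ≡-Reasoning
  length-split : hi ∸ lo ≡ (mid ∸ lo) + (hi ∸ mid)
  length-split = trans (cong (_∸ lo) (sym (m+[n∸m]≡n mid≤hi))) (+-∸-comm (hi ∸ mid) lo≤mid)
  shift : ∀ x → lo + ((mid ∸ lo) + x) ≡ mid + x
  shift x = trans (sym (+-assoc lo (mid ∸ lo) x)) (cong (_+ x) (m+[n∸m]≡n lo≤mid))

count-subrange-≤ : {P : Pred ℕ p} (p? : Decidable P) {lo hi n : ℕ} → lo ≤ hi → hi ≤ n →
                   count p? (range lo hi) ≤ count p? (range 0 n)
count-subrange-≤ p? {lo} {hi} {n} lo≤hi hi≤n = begin
  count p? (range lo hi)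
    ≤⟨ m≤n+m _ (count p? (range 0 lo)) ⟩
  count p? (range 0 lo) + count p? (range lo hi)
    ≤⟨ +-monoʳ-≤ (count p? (range 0 lo)) (m≤m+n _ (count p? (range hi n))) ⟩
  count p? (range 0 lo) + (count p? (range lo hi) + count p? (range hi n))
    ≡⟨ cong (count p? (range 0 lo) +_) (sym (count-++ p? (range lo hi) (range hi n))) ⟩
  count p? (range 0 lo) + count p? (range lo hi ++ range hi n)
    ≡⟨ sym (count-++ p? (range 0 lo) _) ⟩
  count p? (range 0 lo ++ (range lo hi ++ range hi n))
    ≡⟨ cong (count p?) (cong (range 0 lo ++_) (sym (range-split lo≤hi hi≤n))) ⟩
  count p? (range 0 lo ++ range lo n)
    ≡⟨ cong (count p?) (sym (range-split z≤n (≤-trans lo≤hi hi≤n))) ⟩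
  count p? (range 0 n) ∎
  where open ≤-Reasoning

range-All : {P : Pred ℕ p} {lo hi : ℕ} → lo ≤ hi →
            (∀ x → lo ≤ x → x < hi → P x) → All P (range lo hi)
range-All {P = P} {lo} {hi} lo≤hi h =
  subst (All P) (sym (map-upTo (lo +_) (hi ∸ lo))) (applyUpTo⁺₁ (lo +_) (hi ∸ lo) inside)
  where
  inside : ∀ {x} → x < hi ∸ lo → P (lo + x)
  inside x<d = h _ (m≤m+n lo _) (subst (_ <_) (m+[n∸m]≡n lo≤hi) (+-monoʳ-< lo x<d))

Clear : Pred ℕ p → ℕ → ℕ → Set p
Clear C lo hi = ∀ x → lo ≤ x → x < hi → ¬ C x

clear-upward : {C : Pred ℕ p} {lo : ℕ} →
  (∀ b → lo ≤ b → Clear C lo b → ¬ C b) → ∀ b → Clear C lo b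
clear-upward step zero    x _    ()
clear-upward step (suc b) x lo≤x x<1+b with m≤n⇒m<n∨m≡n (≤-pred x<1+b)
... | inj₁ x<b  = clear-upward step b x lo≤x x<b
... | inj₂ refl = step x lo≤x (clear-upward step x)

clear-downward : {C : Pred ℕ p} {hi : ℕ} →
  (∀ a → a < hi → Clear C (suc a) hi → ¬ C a) → ∀ d a → a + d ≡ hi → Clear C a hi
clear-downward step zero    a a≡hi x a≤x x<hi _ =
  <⇒≱ x<hi (subst (_≤ x) (trans (sym (+-identityʳ a)) a≡hi) a≤x)
clear-downward {C = C} {hi} step (suc d) a a+1+d≡hi =
  extend (clear-downward step d (suc a) (trans (sym (+-suc a d)) a+1+d≡hi))
  where
  extend : Clear C (suc a) hi → Clear C a hi
  extend clear x a≤x x<hi with m≤n⇒m<n∨m≡n a≤x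
  ... | inj₁ a<x  = clear x a<x x<hi
  ... | inj₂ refl = step a x<hi clear

-- Both branches of rep have the shape i + x % (j - i + 1), which lies in [i..j].
offset-in-fragment : ∀ i j x → i ≤ j → i ≤ i + x % suc (j ∸ i) × i + x % suc (j ∸ i) ≤ j
offset-in-fragment i j x i≤j =
  m≤m+n i _ ,
  ≤-trans (+-monoʳ-≤ i (≤-pred (m%n<n x (suc (j ∸ i))))) (≤-reflexive (m+[n∸m]≡n i≤j))

rep-in-fragment : ∀ i j a → i ≤ j → i ≤ rep i j a × rep i j a ≤ j
rep-in-fragment i j a i≤j with i ≤ᵇ a
... | true  = offset-in-fragment i j (a ∸ i) i≤j
... | false = offset-in-fragment i j (suc (j ∸ i) ∸ ((i ∸ a) % suc (j ∸ i))) i≤j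

rep-fixes-fragment : ∀ i j a → i ≤ a → a ≤ j → rep i j a ≡ a
rep-fixes-fragment i j a i≤a a≤j with i ≤ᵇ a | ≤⇒≤ᵇ i≤a
... | true | _ = trans (cong (i +_) (m<n⇒m%n≡m (s≤s (∸-monoˡ-≤ i a≤j)))) (m+[n∸m]≡n i≤a)

module _ {A : Set} (eq : DecidableEquality A) {n : ℕ} where

  -- A position of the fragment is its own representative, so misperiods lie
  -- strictly to the left or strictly to the right of the fragment.
  misper-outside : (S : Vec A n) (i j t : ℕ) → IsMisper S i j t → t < i ⊎ j < t
  misper-outside S i j t (_ , differs) with t <? i
  ... | yes t<i = inj₁ t<i
  ... | no t≮i with j <? t
  ... | yes j<t = inj₂ j<t
  ... | no j≮t  = ⊥-elim (differs (cong (at S) (sym (rep-fixes-fragment i j t (≮⇒≥ t≮i) (≮⇒≥ j≮t)))))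

  misperₖ⇒misper : ∀ {k} {S : Vec A n} {i j t} → Misperₖ eq k S i j t → IsMisper S i j t
  misperₖ⇒misper (left  (m , _)) = m
  misperₖ⇒misper (right (m , _)) = m

  misper⇒misperₖ : ∀ {k} (S : Vec A n) (i j : ℕ) → i ≤ n →
    (∀ lo hi → lo ≤ hi → hi ≤ n → countMisper eq S i j lo hi ≤ k) →
    ∀ t → IsMisper S i j t → Misperₖ eq (suc k) S i j t
  misper⇒misperₖ S i j i≤n few t m with misper-outside S i j t m
  ... | inj₁ t<i = left  (m , t<i , s≤s (few (suc t) i t<i i≤n))
  ... | inj₂ j<t = right (m , j<t , s≤s (few (suc j) t j<t (<⇒≤ (proj₁ m))))

module TwoStrings {A : Set} (eq : DecidableEquality A) {n : ℕ} (S S' : Vec A n) (i j : ℕ)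
  (i≤j : i ≤ j) (agree : ∀ t → i ≤ t → t ≤ j → at S t ≡ at S' t) where

  agree-at-rep : ∀ t → at S (rep i j t) ≡ at S' (rep i j t)
  agree-at-rep t = let (i≤r , r≤j) = rep-in-fragment i j t i≤j in agree (rep i j t) i≤r r≤j

  misper-transfer : ∀ t → IsMisper S i j t → at S t ≡ at S' t → IsMisper S' i j t
  misper-transfer t (t<n , differs) same =
    t<n , λ same' → differs (trans same (trans same' (sym (agree-at-rep t))))

  misper-transfer' : ∀ t → IsMisper S' i j t → at S t ≡ at S' t → IsMisper S i j t
  misper-transfer' t (t<n , differs) same =
    t<n , λ same' → differs (trans (sym same) (trans same' (agree-at-rep t)))

  mismatch⇒misper : ∀ t → t < n → at S t ≢ at S' t → IsMisper S i j t ⊎ IsMisper S' i j t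
  mismatch⇒misper t t<n mismatch with MaybeP.≡-dec eq (at S t) (at S (rep i j t))
  ... | no differs = inj₁ (t<n , differs)
  ... | yes same   = inj₂ (t<n , λ same' → mismatch (trans same (trans (agree-at-rep t) (sym same'))))

  Common : ℕ → Set
  Common t = IsMisper S i j t × IsMisper S' i j t

  -- Budget lemma: on an interval without common misperiods, the misperiods of
  -- S and of S' are disjoint sets of mismatches, so together at most hamming.
  budget : ∀ {k} → S =[ k ] S' via eq → ∀ lo hi → lo ≤ hi → hi ≤ n → Clear Common lo hi →
           countMisper eq S i j lo hi + countMisper eq S' i j lo hi ≤ k
  budget {k} ham lo hi lo≤hi hi≤n clear = begin
    countMisper eq S i j lo hi + countMisper eq S' i j lo hi
      ≤⟨ count-disjoint-≤ (isMisper? eq S i j) (isMisper? eq S' i j) differ?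
           (range-All lo≤hi clear) (range-All lo≤hi mismatch-of-one) ⟩
    count differ? (range lo hi)
      ≤⟨ count-subrange-≤ differ? lo≤hi hi≤n ⟩
    hamming eq S S'
      ≤⟨ ham ⟩
    k ∎
    where
    open ≤-Reasoning
    differ? : Decidable (λ t → at S t ≢ at S' t)
    differ? t = ¬? (MaybeP.≡-dec eq (at S t) (at S' t))
    mismatch-of-one : ∀ x → lo ≤ x → x < hi → IsMisper S i j x ⊎ IsMisper S' i j x → at S x ≢ at S' x
    mismatch-of-one x lo≤x x<hi (inj₁ m)  same = clear x lo≤x x<hi (m , misper-transfer x m same)
    mismatch-of-one x lo≤x x<hi (inj₂ m') same = clear x lo≤x x<hi (misper-transfer' x m' same , m')

  -- Under the hypotheses of Lemma 11 there is no common misperiod: the nearest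
  -- one to the fragment, on either side, would lie in both Misper_{k+1}-sets.
  module NoCommon {k} (j<n : j < n) (ham : S =[ k ] S' via eq)
    (disjoint : Disjoint (Misperₖ eq (suc k) S i j) (Misperₖ eq (suc k) S' i j)) where

    i≤n : i ≤ n
    i≤n = <⇒≤ (≤-<-trans i≤j j<n)

    -- A common misperiod t < i with no common misperiod in [t+1 .. i-1] has at
    -- most k misperiods of either string in between, so it is in both sets.
    no-nearest-left : ∀ t → t < i → Clear Common (suc t) i → ¬ Common t
    no-nearest-left t t<i clear (m , m') =
      disjoint t (left (m , t<i , s≤s (m+n≤o⇒m≤o _ few)))
                 (left (m' , t<i , s≤s (m+n≤o⇒n≤o _ few)))
      where
      few : countMisper eq S i j (suc t) i + countMisper eq S' i j (suc t) i ≤ k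
      few = budget ham (suc t) i t<i i≤n clear

    no-nearest-right : ∀ t → suc j ≤ t → Clear Common (suc j) t → ¬ Common t
    no-nearest-right t j<t clear (m , m') =
      disjoint t (right (m , j<t , s≤s (m+n≤o⇒m≤o _ few)))
                 (right (m' , j<t , s≤s (m+n≤o⇒n≤o _ few)))
      where
      few : countMisper eq S i j (suc j) t + countMisper eq S' i j (suc j) t ≤ k
      few = budget ham (suc j) t j<t (<⇒≤ (proj₁ m)) clear

    no-common : ∀ t → ¬ Common t
    no-common t (m , m') with misper-outside eq S i j t m
    ... | inj₁ t<i = clear-downward no-nearest-left i 0 refl t z≤n t<i (m , m')
    ... | inj₂ j<t = clear-upward no-nearest-right (suc t) t j<t ≤-refl (m , m')

    few-misper : ∀ lo hi → lo ≤ hi → hi ≤ n →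
                 countMisper eq S i j lo hi + countMisper eq S' i j lo hi ≤ k
    few-misper lo hi lo≤hi hi≤n = budget ham lo hi lo≤hi hi≤n (λ x _ _ → no-common x)

    all-misperₖ : ∀ t → IsMisper S i j t → Misperₖ eq (suc k) S i j t
    all-misperₖ = misper⇒misperₖ eq S i j i≤n
      (λ lo hi lo≤hi hi≤n → m+n≤o⇒m≤o _ (few-misper lo hi lo≤hi hi≤n))

    all-misperₖ' : ∀ t → IsMisper S' i j t → Misperₖ eq (suc k) S' i j t
    all-misperₖ' = misper⇒misperₖ eq S' i j i≤n
      (λ lo hi lo≤hi hi≤n → m+n≤o⇒n≤o _ (few-misper lo hi lo≤hi hi≤n))

    -- Mismatches are exactly the misperiods of one string: a misperiod of one
    -- string where the strings agree would be common to both.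
    mismatches : Mis S S' ≐ (Misperₖ eq (suc k) S i j ∪ Misperₖ eq (suc k) S' i j)
    mismatches t = mk⇔ to from
      where
      to : Mis S S' t → (Misperₖ eq (suc k) S i j ∪ Misperₖ eq (suc k) S' i j) t
      to (t<n , mismatch) with mismatch⇒misper t t<n mismatch
      ... | inj₁ m  = inl (all-misperₖ t m)
      ... | inj₂ m' = inr (all-misperₖ' t m')
      from : (Misperₖ eq (suc k) S i j ∪ Misperₖ eq (suc k) S' i j) t → Mis S S' t
      from (inl mₖ) = let m = misperₖ⇒misper eq mₖ in
        proj₁ m , λ same → no-common t (m , misper-transfer t m same)
      from (inr mₖ) = let m' = misperₖ⇒misper eq mₖ in
        proj₁ m' , λ same → no-common t (misper-transfer' t m' same , m')

lemma11 : {A : Set} (eq : DecidableEquality A) {n : ℕ} (S S' : Vec A n) (k i j : ℕ) →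
    i ≤ j → j < n →
    S =[ k ] S' via eq →
    (∀ t → i ≤ t → t ≤ j → at S t ≡ at S' t) →
    Disjoint (Misperₖ eq (suc k) S i j) (Misperₖ eq (suc k) S' i j) →
    (Mis S S' ≐ (Misperₖ eq (suc k) S i j ∪ Misperₖ eq (suc k) S' i j))
    × (Misperₖ eq (suc k) S i j ≐ Misper S i j)
    × (Misperₖ eq (suc k) S' i j ≐ Misper S' i j)
lemma11 eq S S' k i j i≤j j<n ham agree disjoint =
    mismatches
  , (λ t → mk⇔ (misperₖ⇒misper eq) (all-misperₖ t))
  , (λ t → mk⇔ (misperₖ⇒misper eq) (all-misperₖ' t))
  where
  open TwoStrings eq S S' i j i≤j agree
  open NoCommon j<n ham disjoint
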